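{- Let $\omega,\omega'\in\Omega$ with $\omega<_S\omega'$. Let $B_1,B_2$ be distinct blocks of $\omega$ that are combinable in $\omega$ (incomparable, or one covers the other) and that are contained in the same block of $\omega'$. Then there exists $\omega''\in\Omega$ with $\omega\lessdot_S\omega''\le_S\omega'$ such that $B_1$ and $B_2$ are contained in the same block of $\omega''$.
   Context: A pre-order on $[n]$ is a reflexive transitive relation $\preceq$; blocks are classes of $i\equiv j\iff i\preceq j\preceq i$, partially ordered by $\preceq$. Blocks overlap if their intervals $[\min,\max]$ intersect; $B'$ covers $B$ if $B\prec B'$ with no block strictly between. $\Omega$ is the set of permutation pre-orders on $[n]$: (P1) overlapping blocks are comparable, (P2) every cover between blocks is between overlapping blocks. $\omega\le_S\omega'$ iff every relation $i\preceq j$ of $\omega$ holds in $\omega'$; $\lessdot_S$ denotes the covering relation of this poset. -}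

module Defs where

open import Data.Nat using (ℕ)
open import Data.Fin using (Fin) renaming (_≤_ to _≤ᶠ_)
open import Data.Bool using (Bool; T)
open import Data.Product using (Σ; _×_; ∃; ∃-syntax)
open import Data.Sum using (_⊎_)
open import Relation.Nullary using (¬_)

BRel : ℕ → Set
BRel n = Fin n → Fin n → Bool

module _ {n : ℕ} (R : BRel n) where

  _≼_ : Fin n → Fin n → Set
  i ≼ j = T (R i j)

  IsPreorder : Set
  IsPreorder = (∀ i → i ≼ i) × (∀ i j k → i ≼ j → j ≼ k → i ≼ k)

  _≈_ : Fin n → Fin n → Set
  i ≈ j = (i ≼ j) × (j ≼ i)

  -- Blocks are represented by a representative element: the block of b is
  -- { k | k ≈ b }.  Block order / strict order on representatives.
  _≺_ : Fin n → Fin n → Set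
  b ≺ c = (b ≼ c) × ¬ (c ≼ b)

  Covers : Fin n → Fin n → Set
  Covers b c = (b ≺ c) × ¬ (∃[ d ] ((b ≺ d) × (d ≺ c)))

  Comparable : Fin n → Fin n → Set
  Comparable b c = (b ≼ c) ⊎ (c ≼ b)

  InInterval : Fin n → Fin n → Set
  InInterval b k = ∃[ x ] ∃[ y ] ((x ≈ b) × (y ≈ b) × (x ≤ᶠ k) × (k ≤ᶠ y))

  Overlap : Fin n → Fin n → Set
  Overlap b c = ∃[ k ] (InInterval b k × InInterval c k)

  P1 : Set
  P1 = ∀ b c → Overlap b c → Comparable b c

  P2 : Set
  P2 = ∀ b c → Covers b c → Overlap b c

  IsPermPreorder : Set
  IsPermPreorder = IsPreorder × P1 × P2

  Combinable : Fin n → Fin n → Set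
  Combinable b c = ¬ Comparable b c ⊎ Covers b c ⊎ Covers c b

_≤S_ : {n : ℕ} → BRel n → BRel n → Set
ω ≤S ω' = ∀ i j → _≼_ ω i j → _≼_ ω' i j

-- ω <_S ω' : ω ≤_S ω' and ω ≠ ω' (extensionally, i.e. ω' ≰_S ω)
_<S_ : {n : ℕ} → BRel n → BRel n → Set
ω <S ω' = (ω ≤S ω') × ¬ (ω' ≤S ω)

_⋖S_ : {n : ℕ} → BRel n → BRel n → Set
_⋖S_ {n} ω ω' = (ω <S ω') × ¬ (Σ (BRel n) λ ω₃ → IsPermPreorder ω₃ × (ω <S ω₃) × (ω₃ <S ω'))

-- Let M = B₁ ∪ B₂.  A block d outside M is *near* if its interval meets the
-- interval of M; a near block goes *up* if it is above M in ω or strictly above b₁ in ω',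
-- otherwise *down*.  Let L be the down-set generated by M and the down-going near blocks,
-- U the up-set generated by M and the up-going near blocks, and put ω'' = ω ∪ (L × U).
module Submission where

open import Defs
open import Data.Nat using (ℕ)
open import Data.Fin using (Fin)
open import Data.Product using (Σ; _×_)
open import Relation.Nullary using (¬_)

open import Data.Fin using () renaming (_≤_ to _≤ᶠ_)
open import Data.Fin.Properties using (any?) renaming (_≤?_ to _≤ᶠ?_)
open import Data.Product using (_,_; proj₁; proj₂; ∃-syntax)
open import Data.Sum using (_⊎_; inj₁; inj₂; swap)
open import Data.Empty using (⊥-elim)
open import Data.List using (List; []; _∷_; allFin)
open import Data.List.Membership.Propositional using (_∈_)
open import Data.List.Membership.Propositional.Properties using (∈-allFin)
open import Data.List.Relation.Unary.Any using (here; there)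
open import Relation.Nullary.Decidable using (Dec; yes; no; _×-dec_; _⊎-dec_; ¬?; ⌊_⌋; toWitness; fromWitness; T?)
open import Relation.Binary.PropositionalEquality using (refl)
open import Function using (flip)

-- k lies between two elements of P in the natural order of [n].  The interval of a block is
-- the hull of the block: InInterval R b is definitionally Hull (λ x → x ≈ b).
Hull : ∀ {n} → (Fin n → Set) → Fin n → Set
Hull P k = ∃[ x ] ∃[ y ] (P x × P y × (x ≤ᶠ k) × (k ≤ᶠ y))

hull-map : ∀ {n} {P Q : Fin n → Set} → (∀ {x} → P x → Q x) → ∀ {k} → Hull P k → Hull Q k
hull-map f (x , y , px , py , x≤k , k≤y) = x , y , f px , f py , x≤k , k≤y

hull? : ∀ {n} {P : Fin n → Set} → (∀ x → Dec (P x)) → ∀ k → Dec (Hull P k)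
hull? P? k = any? λ x → any? λ y → P? x ×-dec P? y ×-dec (x ≤ᶠ? k) ×-dec (k ≤ᶠ? y)

≈-mono : ∀ {n} {R R' : BRel n} → R ≤S R' → ∀ {i j} → _≈_ R i j → _≈_ R' i j
≈-mono R≤R' (i≼j , j≼i) = R≤R' _ _ i≼j , R≤R' _ _ j≼i

interval-mono : ∀ {n} {R R' : BRel n} → R ≤S R' → ∀ {b k} → InInterval R b k → InInterval R' b k
interval-mono R≤R' = hull-map (≈-mono R≤R')

overlap-mono : ∀ {n} {R R' : BRel n} → R ≤S R' → ∀ {b c} → Overlap R b c → Overlap R' b c
overlap-mono R≤R' (k , I , J) = k , interval-mono R≤R' I , interval-mono R≤R' J

comparable-mono : ∀ {n} {R R' : BRel n} → R ≤S R' → ∀ {b c} → Comparable R b c → Comparable R' b c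
comparable-mono R≤R' (inj₁ b≼c) = inj₁ (R≤R' _ _ b≼c)
comparable-mono R≤R' (inj₂ c≼b) = inj₂ (R≤R' _ _ c≼b)

overlap-sym : ∀ {n} {R : BRel n} {b c} → Overlap R b c → Overlap R c b
overlap-sym (k , I , J) = k , J , I

module DecPreorder {n : ℕ} (R : BRel n) (pre : IsPreorder R) where

  _⊑_ _⊏_ _≃_ : Fin n → Fin n → Set
  i ⊑ j = _≼_ R i j
  i ⊏ j = _≺_ R i j
  i ≃ j = _≈_ R i j

  ⊑-refl : ∀ i → i ⊑ i
  ⊑-refl = proj₁ pre

  ⊑-trans : ∀ {i j k} → i ⊑ j → j ⊑ k → i ⊑ k
  ⊑-trans {i} {j} {k} = proj₂ pre i j k

  ≃-refl : ∀ i → i ≃ i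
  ≃-refl i = ⊑-refl i , ⊑-refl i

  ≃-sym : ∀ {i j} → i ≃ j → j ≃ i
  ≃-sym (i⊑j , j⊑i) = j⊑i , i⊑j

  ≃-trans : ∀ {i j k} → i ≃ j → j ≃ k → i ≃ k
  ≃-trans (i⊑j , j⊑i) (j⊑k , k⊑j) = ⊑-trans i⊑j j⊑k , ⊑-trans k⊑j j⊑i

  _⊑?_ : ∀ i j → Dec (i ⊑ j)
  i ⊑? j = T? (R i j)

  _⊏?_ : ∀ i j → Dec (i ⊏ j)
  i ⊏? j = (i ⊑? j) ×-dec ¬? (j ⊑? i)

  _≃?_ : ∀ i j → Dec (i ≃ j)
  i ≃? j = (i ⊑? j) ×-dec (j ⊑? i)

  interval-resp : ∀ {b c k} → b ≃ c → InInterval R b k → InInterval R c k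
  interval-resp b≃c = hull-map λ x≃b → ≃-trans x≃b b≃c

  interval? : ∀ b k → Dec (InInterval R b k)
  interval? b = hull? (λ x → x ≃? b)

  scan : (P : Fin n → Set) → (∀ x → Dec (P x)) → ∀ {e} → P e → (xs : List (Fin n)) →
         Σ (Fin n) λ e' → P e' × e ⊑ e' × (∀ x → x ∈ xs → P x → ¬ (e' ⊏ x))
  scan P P? {e} pe [] = e , pe , ⊑-refl e , λ _ ()
  scan P P? {e} pe (x ∷ xs) with P? x ×-dec (e ⊏? x)
  ... | yes (px , (e⊑x , _)) with scan P P? px xs
  ...   | e' , pe' , x⊑e' , maximal = e' , pe' , ⊑-trans e⊑x x⊑e' , beats
    where
    beats : ∀ y → y ∈ x ∷ xs → P y → ¬ (e' ⊏ y)
    beats y (here refl) _ (_ , x⋢e') = x⋢e' x⊑e'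
    beats y (there y∈xs) py = maximal y y∈xs py
  scan P P? {e} pe (x ∷ xs) | no ¬[px,e⊏x] with scan P P? pe xs
  ...   | e' , pe' , e⊑e' , maximal = e' , pe' , e⊑e' , beats
    where
    beats : ∀ y → y ∈ x ∷ xs → P y → ¬ (e' ⊏ y)
    beats y (here refl) py (e'⊑y , y⋢e') =
      ¬[px,e⊏x] (py , ⊑-trans e⊑e' e'⊑y , λ y⊑e → y⋢e' (⊑-trans y⊑e e⊑e'))
    beats y (there y∈xs) py = maximal y y∈xs py

  maximal-above : (P : Fin n → Set) → (∀ x → Dec (P x)) → ∀ {e₀} → P e₀ →
                  Σ (Fin n) λ e → P e × e₀ ⊑ e × (∀ x → P x → ¬ (e ⊏ x))
  maximal-above P P? pe₀ with scan P P? pe₀ (allFin n)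
  ... | e , pe , e₀⊑e , maximal = e , pe , e₀⊑e , λ x → maximal x (∈-allFin x)

  -- If b ⊏ c, some block above b is covered by c: a maximal element of [b, c).
  cover-below : ∀ {b c} → b ⊏ c → Σ (Fin n) λ e → b ⊑ e × Covers R e c
  cover-below {b} {c} b⊏c
    with maximal-above (λ x → b ⊑ x × x ⊏ c) (λ x → (b ⊑? x) ×-dec (x ⊏? c)) (⊑-refl b , b⊏c)
  ... | e , (b⊑e , e⊏c) , _ , maximal =
        e , b⊑e , e⊏c , λ (d , e⊏d , d⊏c) → maximal d (⊑-trans b⊑e (proj₁ e⊏d) , d⊏c) e⊏d

  cover-interval : ∀ {b c i} → Covers R b c → b ⊑ i → i ⊑ c → (i ≃ b) ⊎ (i ≃ c)
  cover-interval {b} {c} {i} (_ , nothing-between) b⊑i i⊑c with i ⊑? b | c ⊑? i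
  ... | yes i⊑b | _ = inj₁ (i⊑b , b⊑i)
  ... | no _ | yes c⊑i = inj₂ (i⊑c , c⊑i)
  ... | no i⋢b | no c⋢i = ⊥-elim (nothing-between (i , (b⊑i , i⋢b) , (i⊑c , c⋢i)))

  combinable-sym : ∀ {b c} → Combinable R b c → Combinable R c b
  combinable-sym (inj₁ incomparable) = inj₁ λ c~b → incomparable (swap c~b)
  combinable-sym (inj₂ (inj₁ b⋖c)) = inj₂ (inj₂ b⋖c)
  combinable-sym (inj₂ (inj₂ c⋖b)) = inj₂ (inj₁ c⋖b)

  combinable-cover : ∀ {b c} → Combinable R b c → c ⊑ b → Covers R c b
  combinable-cover (inj₁ incomparable) c⊑b = ⊥-elim (incomparable (inj₂ c⊑b))
  combinable-cover (inj₂ (inj₁ ((_ , c⋢b) , _))) c⊑b = ⊥-elim (c⋢b c⊑b)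
  combinable-cover (inj₂ (inj₂ c⋖b)) _ = c⋖b

flip-preorder : ∀ {n} {R : BRel n} → IsPreorder R → IsPreorder (flip R)
flip-preorder (refl-R , trans-R) = refl-R , λ i j k j≼i k≼j → trans-R k j i k≼j j≼i

module DecPreorderDual {n : ℕ} (R : BRel n) (pre : IsPreorder R) where
  open DecPreorder R pre
  private module Op = DecPreorder (flip R) (flip-preorder pre)

  minimal-below : (P : Fin n → Set) → (∀ x → Dec (P x)) → ∀ {e₀} → P e₀ →
                  Σ (Fin n) λ e → P e × e ⊑ e₀ × (∀ x → P x → ¬ (x ⊏ e))
  minimal-below = Op.maximal-above

  cover-above : ∀ {b c} → b ⊏ c → Σ (Fin n) λ e → e ⊑ c × Covers R b e
  cover-above b⊏c with Op.cover-below b⊏c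
  ... | e , e⊑c , b⊏e , nothing-between =
        e , e⊑c , b⊏e , λ (d , b⊏d , d⊏e) → nothing-between (d , d⊏e , b⊏d)

-- Otherwise take i and an x-minimal e with i ⊑ˣ e but i ⋢ e; a cover
-- f ⋖ˣ e with i ⊑ˣ f has i ⊑ f by minimality, and by (P2), (P1) the blocks f, e are
-- ω-comparable: f ⊑ e gives i ⊑ e, and e ⊑ f contradicts f ⊏ˣ e.
module SameBlocks {n : ℕ} (ω x : BRel n) (preω : IsPreorder ω) (prex : IsPreorder x)
                  (P1ω : P1 ω) (P2x : P2 x) (ω≤x : ω ≤S x)
                  (same : ∀ {i j} → _≈_ x i j → _≈_ ω i j) where
  open DecPreorder ω preω
  private module X = DecPreorder x prex
  open X using () renaming (_⊑_ to _⊑ˣ_; _⊑?_ to _⊑ˣ?_)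
  open DecPreorderDual x prex using (minimal-below)

  overlap-back : ∀ {b c} → Overlap x b c → Overlap ω b c
  overlap-back (k , Ib , Ic) = k , hull-map same Ib , hull-map same Ic

  x≤ω : x ≤S ω
  x≤ω i j i⊑ˣj with i ⊑? j
  ... | yes i⊑j = i⊑j
  ... | no i⋢j with minimal-below (λ e → i ⊑ˣ e × ¬ (i ⊑ e)) (λ e → (i ⊑ˣ? e) ×-dec ¬? (i ⊑? e)) (i⊑ˣj , i⋢j)
  ...   | e , (i⊑ˣe , i⋢e) , _ , minimal with X.cover-below (i⊑ˣe , λ e⊑ˣi → i⋢e (proj₂ (same (e⊑ˣi , i⊑ˣe))))
  ...     | f , i⊑ˣf , f⋖ˣe with i ⊑? f
  ...       | no i⋢f = ⊥-elim (minimal f (i⊑ˣf , i⋢f) (proj₁ f⋖ˣe))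
  ...       | yes i⊑f with P1ω f e (overlap-back (P2x f e f⋖ˣe))
  ...         | inj₁ f⊑e = ⊥-elim (i⋢e (⊑-trans i⊑f f⊑e))
  ...         | inj₂ e⊑f = ⊥-elim (proj₂ (proj₁ f⋖ˣe) (ω≤x _ _ e⊑f))

Adjoined : ∀ {n} → BRel n → (L U : Fin n → Set) → Fin n → Fin n → Set
Adjoined R L U i j = _≼_ R i j ⊎ (L i × U j)

adjoin : ∀ {n} (R : BRel n) {L U : Fin n → Set} → (∀ i → Dec (L i)) → (∀ j → Dec (U j)) → BRel n
adjoin R L? U? i j = ⌊ T? (R i j) ⊎-dec (L? i ×-dec U? j) ⌋

adjoin-intro : ∀ {n} (R : BRel n) {L U : Fin n → Set} (L? : ∀ i → Dec (L i)) (U? : ∀ j → Dec (U j)) →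
               ∀ {i j} → Adjoined R L U i j → _≼_ (adjoin R L? U?) i j
adjoin-intro R L? U? {i} {j} = fromWitness {a? = T? (R i j) ⊎-dec (L? i ×-dec U? j)}

adjoin-elim : ∀ {n} (R : BRel n) {L U : Fin n → Set} (L? : ∀ i → Dec (L i)) (U? : ∀ j → Dec (U j)) →
              ∀ {i j} → _≼_ (adjoin R L? U?) i j → Adjoined R L U i j
adjoin-elim R L? U? {i} {j} = toWitness {a? = T? (R i j) ⊎-dec (L? i ×-dec U? j)}

module Adjoin {n : ℕ} (R : BRel n) (pre : IsPreorder R) (L U : Fin n → Set)
              (L-down : ∀ {i j} → _≼_ R i j → L j → L i)
              (U-up : ∀ {i j} → _≼_ R i j → U i → U j)
              (R⁺ : BRel n)
              (intro : ∀ {i j} → Adjoined R L U i j → _≼_ R⁺ i j)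
              (elim : ∀ {i j} → _≼_ R⁺ i j → Adjoined R L U i j) where
  open DecPreorder R pre

  Core : Fin n → Set
  Core i = L i × U i

  R⁺-preorder : IsPreorder R⁺
  R⁺-preorder = (λ i → intro (inj₁ (⊑-refl i))) , λ i j k i≼j j≼k → intro (trans (elim i≼j) (elim j≼k))
    where
    trans : ∀ {i j k} → Adjoined R L U i j → Adjoined R L U j k → Adjoined R L U i k
    trans (inj₁ i⊑j) (inj₁ j⊑k) = inj₁ (⊑-trans i⊑j j⊑k)
    trans (inj₁ i⊑j) (inj₂ (Lj , Uk)) = inj₂ (L-down i⊑j Lj , Uk)
    trans (inj₂ (Li , Uj)) (inj₁ j⊑k) = inj₂ (Li , U-up j⊑k Uj)
    trans (inj₂ (Li , _)) (inj₂ (_ , Uk)) = inj₂ (Li , Uk)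

  R≤R⁺ : R ≤S R⁺
  R≤R⁺ i j i⊑j = intro (inj₁ i⊑j)

  L-down⁺ : ∀ {i j} → _≼_ R⁺ i j → L j → L i
  L-down⁺ i≼j Lj with elim i≼j
  ... | inj₁ i⊑j = L-down i⊑j Lj
  ... | inj₂ (Li , _) = Li

  U-up⁺ : ∀ {i j} → _≼_ R⁺ i j → U i → U j
  U-up⁺ i≼j Ui with elim i≼j
  ... | inj₁ i⊑j = U-up i⊑j Ui
  ... | inj₂ (_ , Uj) = Uj

  core-equiv : ∀ {i j} → Core i → Core j → _≈_ R⁺ i j
  core-equiv (Li , Ui) (Lj , Uj) = intro (inj₂ (Li , Uj)) , intro (inj₂ (Lj , Ui))

  R⁺-equiv : ∀ {i j} → _≈_ R⁺ i j → (i ≃ j) ⊎ (Core i × Core j)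
  R⁺-equiv (i≼j , j≼i) with elim i≼j | elim j≼i
  ... | inj₁ i⊑j | inj₁ j⊑i = inj₁ (i⊑j , j⊑i)
  ... | inj₁ i⊑j | inj₂ (Lj , Ui) = inj₂ ((L-down i⊑j Lj , Ui) , (Lj , U-up i⊑j Ui))
  ... | inj₂ (Li , Uj) | inj₁ j⊑i = inj₂ ((Li , U-up j⊑i Uj) , (L-down j⊑i Li , Uj))
  ... | inj₂ (Li , Uj) | inj₂ (Lj , Ui) = inj₂ ((Li , Ui) , (Lj , Uj))

  strict-lift : ∀ {i j} → i ⊏ j → ¬ (Core i × Core j) → _≺_ R⁺ i j
  strict-lift {i} {j} (i⊑j , j⋢i) not-core =
    R≤R⁺ _ _ i⊑j , λ j≼i → case (R⁺-equiv (R≤R⁺ _ _ i⊑j , j≼i))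
    where
    case : ¬ ((i ≃ j) ⊎ (Core i × Core j))
    case (inj₁ (_ , j⊑i)) = j⋢i j⊑i
    case (inj₂ cores) = not-core cores

  strict-across : ∀ {i j} → L i → U j → ¬ (Core i × Core j) → _≺_ R⁺ i j
  strict-across Li Uj not-core =
    intro (inj₂ (Li , Uj)) , λ j≼i → not-core ((Li , U-up⁺ j≼i Uj) , (L-down⁺ j≼i Li , Uj))

  interval-outside-core : ∀ {b k} → ¬ Core b → InInterval R⁺ b k → InInterval R b k
  interval-outside-core {b} b∉core = hull-map λ x≈b → case (R⁺-equiv x≈b)
    where
    case : ∀ {x} → (x ≃ b) ⊎ (Core x × Core b) → x ≃ b
    case (inj₁ x≃b) = x≃b
    case (inj₂ (_ , b∈core)) = ⊥-elim (b∉core b∈core)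

module Merge {n : ℕ} (ω ω' : BRel n) (Ωω : IsPermPreorder ω) (Ωω' : IsPermPreorder ω')
             (ω≤ω' : ω ≤S ω') (b₁ b₂ : Fin n) (comb : Combinable ω b₁ b₂)
             (b₁≈'b₂ : _≈_ ω' b₁ b₂) where

  open DecPreorder ω (proj₁ Ωω)
  open DecPreorder ω' (proj₁ Ωω') using () renaming (_⊑_ to _⊑'_; ⊑-trans to ⊑'-trans; _⊑?_ to _⊑'?_)

  P1ω : P1 ω
  P1ω = proj₁ (proj₂ Ωω)

  P2ω : P2 ω
  P2ω = proj₂ (proj₂ Ωω)

  InM Below Above : Fin n → Set
  InM i = (i ≃ b₁) ⊎ (i ≃ b₂)
  Below i = (i ⊑ b₁) ⊎ (i ⊑ b₂)
  Above i = (b₁ ⊑ i) ⊎ (b₂ ⊑ i)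

  InM? : ∀ i → Dec (InM i)
  InM? i = (i ≃? b₁) ⊎-dec (i ≃? b₂)

  b₁∈M : InM b₁
  b₁∈M = inj₁ (≃-refl b₁)

  b₂∈M : InM b₂
  b₂∈M = inj₂ (≃-refl b₂)

  M-resp : ∀ {i j} → i ≃ j → InM j → InM i
  M-resp i≃j (inj₁ j≃b₁) = inj₁ (≃-trans i≃j j≃b₁)
  M-resp i≃j (inj₂ j≃b₂) = inj₂ (≃-trans i≃j j≃b₂)

  M-below : ∀ {i} → InM i → Below i
  M-below (inj₁ (i⊑b₁ , _)) = inj₁ i⊑b₁
  M-below (inj₂ (i⊑b₂ , _)) = inj₂ i⊑b₂

  M-above : ∀ {i} → InM i → Above i
  M-above (inj₁ (_ , b₁⊑i)) = inj₁ b₁⊑i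
  M-above (inj₂ (_ , b₂⊑i)) = inj₂ b₂⊑i

  below-down : ∀ {i j} → i ⊑ j → Below j → Below i
  below-down i⊑j (inj₁ j⊑b₁) = inj₁ (⊑-trans i⊑j j⊑b₁)
  below-down i⊑j (inj₂ j⊑b₂) = inj₂ (⊑-trans i⊑j j⊑b₂)

  above-up : ∀ {i j} → i ⊑ j → Above i → Above j
  above-up i⊑j (inj₁ b₁⊑i) = inj₁ (⊑-trans b₁⊑i i⊑j)
  above-up i⊑j (inj₂ b₂⊑i) = inj₂ (⊑-trans b₂⊑i i⊑j)

  above-witness : ∀ {i} → Above i → ∃[ a ] (InM a × a ⊑ i)
  above-witness (inj₁ b₁⊑i) = b₁ , b₁∈M , b₁⊑i
  above-witness (inj₂ b₂⊑i) = b₂ , b₂∈M , b₂⊑i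

  below-witness : ∀ {i} → Below i → ∃[ a ] (InM a × i ⊑ a)
  below-witness (inj₁ i⊑b₁) = b₁ , b₁∈M , i⊑b₁
  below-witness (inj₂ i⊑b₂) = b₂ , b₂∈M , i⊑b₂

  -- M is convex: since B₁, B₂ are combinable, nothing lies strictly between them.
  M-convex : ∀ {i} → Above i → Below i → InM i
  M-convex (inj₁ b₁⊑i) (inj₁ i⊑b₁) = inj₁ (i⊑b₁ , b₁⊑i)
  M-convex (inj₂ b₂⊑i) (inj₂ i⊑b₂) = inj₂ (i⊑b₂ , b₂⊑i)
  M-convex (inj₂ b₂⊑i) (inj₁ i⊑b₁) =
    swap (cover-interval (combinable-cover comb (⊑-trans b₂⊑i i⊑b₁)) b₂⊑i i⊑b₁)
  M-convex (inj₁ b₁⊑i) (inj₂ i⊑b₂) =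
    cover-interval (combinable-cover (combinable-sym comb) (⊑-trans b₁⊑i i⊑b₂)) b₁⊑i i⊑b₂

  Near : Fin n → Set
  Near d = ¬ InM d × ∃[ k ] (InInterval ω d k × Hull InM k)

  Near? : ∀ d → Dec (Near d)
  Near? d = ¬? (InM? d) ×-dec any? λ k → interval? d k ×-dec hull? InM? k

  near-resp : ∀ {d c} → d ≃ c → ¬ InM c → Near d → Near c
  near-resp d≃c c∉M (_ , k , Id , Jk) = c∉M , k , interval-resp d≃c Id , Jk

  GoesUp : Fin n → Set
  GoesUp d = Above d ⊎ ((b₁ ⊑' d) × ¬ (d ⊑' b₁))

  GoesUp? : ∀ d → Dec (GoesUp d)
  GoesUp? d = ((b₁ ⊑? d) ⊎-dec (b₂ ⊑? d)) ⊎-dec ((b₁ ⊑'? d) ×-dec ¬? (d ⊑'? b₁))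

  NearUp NearDown : Fin n → Set
  NearUp d = Near d × GoesUp d
  NearDown d = Near d × ¬ GoesUp d

  L U : Fin n → Set
  L i = Below i ⊎ ∃[ d ] (NearDown d × i ⊑ d)
  U j = Above j ⊎ ∃[ d ] (NearUp d × d ⊑ j)

  L? : ∀ i → Dec (L i)
  L? i = ((i ⊑? b₁) ⊎-dec (i ⊑? b₂)) ⊎-dec any? λ d → (Near? d ×-dec ¬? (GoesUp? d)) ×-dec (i ⊑? d)

  U? : ∀ j → Dec (U j)
  U? j = ((b₁ ⊑? j) ⊎-dec (b₂ ⊑? j)) ⊎-dec any? λ d → (Near? d ×-dec GoesUp? d) ×-dec (d ⊑? j)

  L-down : ∀ {i j} → i ⊑ j → L j → L i
  L-down i⊑j (inj₁ below) = inj₁ (below-down i⊑j below)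
  L-down i⊑j (inj₂ (d , down , j⊑d)) = inj₂ (d , down , ⊑-trans i⊑j j⊑d)

  U-up : ∀ {i j} → i ⊑ j → U i → U j
  U-up i⊑j (inj₁ above) = inj₁ (above-up i⊑j above)
  U-up i⊑j (inj₂ (d , up , d⊑i)) = inj₂ (d , up , ⊑-trans d⊑i i⊑j)

  module Collapse (y : BRel n) (prey : IsPreorder y) (ω≤y : ω ≤S y) (b₁≈ʸb₂ : _≈_ y b₁ b₂) where
    open DecPreorder y prey using ()
      renaming (_⊑_ to _⊑ʸ_; ⊑-trans to ⊑ʸ-trans; ≃-trans to ≃ʸ-trans; ≃-sym to ≃ʸ-sym)

    M-collapses : ∀ {i} → InM i → _≈_ y i b₁
    M-collapses (inj₁ i≃b₁) = ≈-mono ω≤y i≃b₁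
    M-collapses (inj₂ i≃b₂) = ≃ʸ-trans (≈-mono ω≤y i≃b₂) (≃ʸ-sym b₁≈ʸb₂)

    below-b₁ : ∀ {i} → Below i → i ⊑ʸ b₁
    below-b₁ below with below-witness below
    ... | a , a∈M , i⊑a = ⊑ʸ-trans (ω≤y _ _ i⊑a) (proj₁ (M-collapses a∈M))

    above-b₁ : ∀ {i} → Above i → b₁ ⊑ʸ i
    above-b₁ above with above-witness above
    ... | a , a∈M , a⊑i = ⊑ʸ-trans (proj₂ (M-collapses a∈M)) (ω≤y _ _ a⊑i)

    near-overlaps : ∀ {d} → Near d → Overlap y d b₁
    near-overlaps (_ , k , Id , Jk) = k , interval-mono ω≤y Id , hull-map M-collapses Jk

  open Collapse ω' (proj₁ Ωω') ω≤ω' b₁≈'b₂ using ()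
    renaming (below-b₁ to below-b₁'; above-b₁ to above-b₁'; near-overlaps to near-overlaps')

  up-not-below : ∀ {d} → NearUp d → ¬ Below d
  up-not-below ((d∉M , _) , inj₁ above) below = d∉M (M-convex above below)
  up-not-below (_ , inj₂ (_ , d⋢'b₁)) below = d⋢'b₁ (below-b₁' below)

  down-not-above : ∀ {d} → NearDown d → ¬ Above d
  down-not-above (_ , not-up) above = not-up (inj₁ above)

  up-not-under-down : ∀ {d d'} → NearDown d → NearUp d' → ¬ (d' ⊑ d)
  up-not-under-down (_ , not-up) (_ , inj₁ above) d'⊑d = not-up (inj₁ (above-up d'⊑d above))
  up-not-under-down (_ , not-up) (_ , inj₂ (b₁⊑'d' , d'⋢'b₁)) d'⊑d =
    not-up (inj₂ (⊑'-trans b₁⊑'d' (ω≤ω' _ _ d'⊑d) , λ d⊑'b₁ → d'⋢'b₁ (⊑'-trans (ω≤ω' _ _ d'⊑d) d⊑'b₁)))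

  core⇒M : ∀ {i} → L i × U i → InM i
  core⇒M (inj₁ below , inj₁ above) = M-convex above below
  core⇒M (inj₁ below , inj₂ (d , up , d⊑i)) = ⊥-elim (up-not-below up (below-down d⊑i below))
  core⇒M (inj₂ (d , down , i⊑d) , inj₁ above) = ⊥-elim (down-not-above down (above-up i⊑d above))
  core⇒M (inj₂ (d , down , i⊑d) , inj₂ (d' , up , d'⊑i)) = ⊥-elim (up-not-under-down down up (⊑-trans d'⊑i i⊑d))

  M⇒core : ∀ {i} → InM i → L i × U i
  M⇒core i∈M = inj₁ (M-below i∈M) , inj₁ (M-above i∈M)

  -- ω'' is used only through its characterisation as ω ∪ (L × U); keeping it opaque also
  -- keeps the decision procedures L?, U? out of type-checking.
  abstract
    ω'' : BRel n
    ω'' = adjoin ω L? U?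

    ω''-intro : ∀ {i j} → Adjoined ω L U i j → _≼_ ω'' i j
    ω''-intro = adjoin-intro ω L? U?

    ω''-elim : ∀ {i j} → _≼_ ω'' i j → Adjoined ω L U i j
    ω''-elim = adjoin-elim ω L? U?

  private module A = Adjoin ω (proj₁ Ωω) L U L-down U-up ω'' ω''-intro ω''-elim

  ω''-preorder : IsPreorder ω''
  ω''-preorder = A.R⁺-preorder

  ω≤ω'' : ω ≤S ω''
  ω≤ω'' = A.R≤R⁺

  open DecPreorder ω'' ω''-preorder using () renaming (_⊏_ to _⊏″_; _≃_ to _≃″_)

  M-related : ∀ {i j} → InM i → InM j → i ≃″ j
  M-related i∈M j∈M = A.core-equiv (M⇒core i∈M) (M⇒core j∈M)

  b₁≃″b₂ : b₁ ≃″ b₂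
  b₁≃″b₂ = M-related b₁∈M b₂∈M

  ω<ω'' : ¬ (b₁ ≃ b₂) → ω <S ω''
  ω<ω'' b₁≉b₂ = ω≤ω'' , λ ω''≤ω → b₁≉b₂ (ω''≤ω _ _ (proj₁ b₁≃″b₂) , ω''≤ω _ _ (proj₂ b₁≃″b₂))

  ≃″-cases : ∀ {i j} → i ≃″ j → (i ≃ j) ⊎ (InM i × InM j)
  ≃″-cases i≃″j with A.R⁺-equiv i≃″j
  ... | inj₁ i≃j = inj₁ i≃j
  ... | inj₂ (i-core , j-core) = inj₂ (core⇒M i-core , core⇒M j-core)

  outsideˡ : ∀ {i j} → ¬ InM i → ¬ (A.Core i × A.Core j)
  outsideˡ i∉M (i-core , _) = i∉M (core⇒M i-core)

  outsideʳ : ∀ {i j} → ¬ InM j → ¬ (A.Core i × A.Core j)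
  outsideʳ j∉M (_ , j-core) = j∉M (core⇒M j-core)

  interval-outside : ∀ {b k} → ¬ InM b → InInterval ω'' b k → InInterval ω b k
  interval-outside b∉M = A.interval-outside-core λ b-core → b∉M (core⇒M b-core)

  interval-M : ∀ {b k} → InM b → InInterval ω b k → Hull InM k
  interval-M b∈M = hull-map λ x≃b → M-resp x≃b b∈M

  interval-M″ : ∀ {b k} → InM b → InInterval ω'' b k → Hull InM k
  interval-M″ {b} b∈M = hull-map λ x≃″b → case (≃″-cases x≃″b)
    where
    case : ∀ {x} → (x ≃ b) ⊎ (InM x × InM b) → InM x
    case (inj₁ x≃b) = M-resp x≃b b∈M
    case (inj₂ (x∈M , _)) = x∈M

  overlap-outside : ∀ {b c} → ¬ InM b → ¬ InM c → Overlap ω'' b c → Overlap ω b c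
  overlap-outside b∉M c∉M (k , Ib , Ic) = k , interval-outside b∉M Ib , interval-outside c∉M Ic

  M-interval″ : ∀ {b k} → InM b → Hull InM k → InInterval ω'' b k
  M-interval″ b∈M = hull-map λ x∈M → M-related x∈M b∈M

  -- (P1).  A block outside M overlapping M in ω'' is near, and near blocks were placed
  -- above or below M.
  near-of-overlap : ∀ {d c} → ¬ InM d → InM c → Overlap ω'' d c → Near d
  near-of-overlap d∉M c∈M (k , Id , Ic) = d∉M , k , interval-outside d∉M Id , interval-M″ c∈M Ic

  near-comparable : ∀ {d c} → Near d → InM c → Comparable ω'' d c
  near-comparable {d} near c∈M with GoesUp? d
  ... | yes up = inj₂ (ω''-intro (inj₂ (proj₁ (M⇒core c∈M) , inj₂ (d , (near , up) , ⊑-refl d))))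
  ... | no not-up = inj₁ (ω''-intro (inj₂ (inj₂ (d , (near , not-up) , ⊑-refl d) , proj₂ (M⇒core c∈M))))

  ω''-P1 : P1 ω''
  ω''-P1 b c ov with InM? b | InM? c
  ... | yes b∈M | yes c∈M = inj₁ (proj₁ (M-related b∈M c∈M))
  ... | no b∉M | yes c∈M = near-comparable (near-of-overlap b∉M c∈M ov) c∈M
  ... | yes b∈M | no c∉M = swap (near-comparable (near-of-overlap c∉M b∈M (overlap-sym {R = ω''} ov)) b∈M)
  ... | no b∉M | no c∉M = comparable-mono ω≤ω'' (P1ω b c (overlap-outside b∉M c∉M ov))

  -- (P2).  Between M and a block c ∉ M above it that is not near there is always a block of
  -- ω'': either an up-going near block below c, or the block covered by c over M in ω.
  between-above : ∀ {b c} → InM b → ¬ InM c → ¬ Near c → U c → ∃[ d ] (b ⊏″ d × d ⊏″ c)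
  between-above b∈M c∉M c-far (inj₂ (d , up@((d∉M , _) , _) , d⊑c)) =
    d , A.strict-across (proj₁ (M⇒core b∈M)) (inj₂ (d , up , ⊑-refl d)) (outsideʳ d∉M)
      , A.strict-lift (d⊑c , λ c⊑d → c-far (near-resp (d⊑c , c⊑d) c∉M (proj₁ up))) (outsideʳ c∉M)
  between-above {c = c} b∈M c∉M c-far (inj₁ above) with above-witness above
  ... | a , a∈M , a⊑c with cover-below (a⊑c , λ c⊑a → c∉M (M-resp (c⊑a , a⊑c) a∈M))
  ...   | e , a⊑e , e⋖c with InM? e | P2ω e c e⋖c
  ...     | yes e∈M | k , Ie , Ic = ⊥-elim (c-far (c∉M , k , Ic , interval-M e∈M Ie))
  ...     | no e∉M | _ =
            e , A.strict-across (proj₁ (M⇒core b∈M)) (inj₁ (above-up a⊑e (M-above a∈M))) (outsideʳ e∉M)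
              , A.strict-lift (proj₁ e⋖c) (outsideʳ c∉M)

  between-below : ∀ {b c} → InM c → ¬ InM b → ¬ Near b → L b → ∃[ d ] (b ⊏″ d × d ⊏″ c)
  between-below c∈M b∉M b-far (inj₂ (d , down@((d∉M , _) , _) , b⊑d)) =
    d , A.strict-lift (b⊑d , λ d⊑b → b-far (near-resp (d⊑b , b⊑d) b∉M (proj₁ down))) (outsideˡ b∉M)
      , A.strict-across (inj₂ (d , down , ⊑-refl d)) (proj₂ (M⇒core c∈M)) (outsideˡ d∉M)
  between-below {b = b} c∈M b∉M b-far (inj₁ below) with below-witness below
  ... | a , a∈M , b⊑a with cover-above (b⊑a , λ a⊑b → b∉M (M-resp (b⊑a , a⊑b) a∈M))
    where open DecPreorderDual ω (proj₁ Ωω)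
  ...   | e , e⊑a , b⋖e with InM? e | P2ω b e b⋖e
  ...     | yes e∈M | k , Ib , Ie = ⊥-elim (b-far (b∉M , k , Ib , interval-M e∈M Ie))
  ...     | no e∉M | _ =
            e , A.strict-lift (proj₁ b⋖e) (outsideˡ b∉M)
              , A.strict-across (inj₁ (below-down e⊑a (M-below a∈M))) (proj₂ (M⇒core c∈M)) (outsideˡ e∉M)

  cover-from-M : ∀ {b c} → InM b → ¬ InM c → Covers ω'' b c → Overlap ω'' b c
  cover-from-M {c = c} b∈M c∉M ((b⊑″c , _) , nothing-between) with Near? c
  ... | yes (_ , k , Ic , Jk) = k , M-interval″ b∈M Jk , interval-mono ω≤ω'' Ic
  ... | no c-far =
        ⊥-elim (nothing-between (between-above b∈M c∉M c-far (A.U-up⁺ b⊑″c (proj₂ (M⇒core b∈M)))))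

  cover-into-M : ∀ {b c} → ¬ InM b → InM c → Covers ω'' b c → Overlap ω'' b c
  cover-into-M {b = b} b∉M c∈M ((b⊑″c , _) , nothing-between) with Near? b
  ... | yes (_ , k , Ib , Jk) = k , interval-mono ω≤ω'' Ib , M-interval″ c∈M Jk
  ... | no b-far =
        ⊥-elim (nothing-between (between-below c∈M b∉M b-far (A.L-down⁺ b⊑″c (proj₁ (M⇒core c∈M)))))

  -- A cover of ω'' outside M is either a cover of ω, or skips over M.
  cover-outside : ∀ {b c} → ¬ InM b → ¬ InM c → Covers ω'' b c → Overlap ω'' b c
  cover-outside {b} {c} b∉M c∉M ((b⊑″c , c⋢″b) , nothing-between) with ω''-elim b⊑″c
  ... | inj₂ (Lb , Uc) =
        ⊥-elim (nothing-between (b₁ , A.strict-across Lb (proj₂ (M⇒core b₁∈M)) (outsideˡ b∉M)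
                                    , A.strict-across (proj₁ (M⇒core b₁∈M)) Uc (outsideʳ c∉M)))
  ... | inj₁ b⊑c = overlap-mono ω≤ω'' (P2ω b c ((b⊑c , λ c⊑b → c⋢″b (ω≤ω'' _ _ c⊑b)) , no-ω-between))
    where
    no-ω-between : ¬ (∃[ d ] (b ⊏ d × d ⊏ c))
    no-ω-between (d , b⊏d , d⊏c) =
      nothing-between (d , A.strict-lift b⊏d (outsideˡ b∉M) , A.strict-lift d⊏c (outsideʳ c∉M))

  ω''-P2 : P2 ω''
  ω''-P2 b c b⋖c with InM? b | InM? c
  ... | yes b∈M | yes c∈M = ⊥-elim (proj₂ (proj₁ b⋖c) (proj₂ (M-related b∈M c∈M)))
  ... | yes b∈M | no c∉M = cover-from-M b∈M c∉M b⋖c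
  ... | no b∉M | yes c∈M = cover-into-M b∉M c∈M b⋖c
  ... | no b∉M | no c∉M = cover-outside b∉M c∉M b⋖c

  ω''-least : (y : BRel n) (prey : IsPreorder y) → ω ≤S y → (b₁≈ʸb₂ : _≈_ y b₁ b₂) →
              (∀ {d} → NearDown d → _≼_ y d b₁) → (∀ {d} → NearUp d → _≼_ y b₁ d) → ω'' ≤S y
  ω''-least y prey ω≤y b₁≈ʸb₂ down-below up-above i j i⊑″j with ω''-elim i⊑″j
  ... | inj₁ i⊑j = ω≤y _ _ i⊑j
  ... | inj₂ (Li , Uj) = ⊑ʸ-trans (L-below Li) (U-above Uj)
    where
    open DecPreorder y prey using () renaming (⊑-trans to ⊑ʸ-trans)
    open Collapse y prey ω≤y b₁≈ʸb₂ using (below-b₁; above-b₁)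

    L-below : ∀ {i} → L i → _≼_ y i b₁
    L-below (inj₁ below) = below-b₁ below
    L-below (inj₂ (d , down , i⊑d)) = ⊑ʸ-trans (ω≤y _ _ i⊑d) (down-below down)

    U-above : ∀ {j} → U j → _≼_ y b₁ j
    U-above (inj₁ above) = above-b₁ above
    U-above (inj₂ (d , up , d⊑j)) = ⊑ʸ-trans (up-above up) (ω≤y _ _ d⊑j)

  -- ω' orients the near blocks as ω'' does: a down-going near block is ω'-comparable with b₁
  -- by (P1) but not strictly above it, and an up-going one is above b₁ in ω' by definition.
  ω''≤ω' : ω'' ≤S ω'
  ω''≤ω' = ω''-least ω' (proj₁ Ωω') ω≤ω' b₁≈'b₂ down-below up-above
    where
    down-below : ∀ {d} → NearDown d → d ⊑' b₁
    down-below {d} down with proj₁ (proj₂ Ωω') d b₁ (near-overlaps' (proj₁ down)) | d ⊑'? b₁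
    ... | inj₁ d⊑'b₁ | _ = d⊑'b₁
    ... | inj₂ _ | yes d⊑'b₁ = d⊑'b₁
    ... | inj₂ b₁⊑'d | no d⋢'b₁ = ⊥-elim (proj₂ down (inj₂ (b₁⊑'d , d⋢'b₁)))

    up-above : ∀ {d} → NearUp d → b₁ ⊑' d
    up-above (_ , inj₁ above) = above-b₁' above
    up-above (_ , inj₂ (b₁⊑'d , _)) = b₁⊑'d

  module Intermediate (x : BRel n) (Ωx : IsPermPreorder x) (ω≤x : ω ≤S x) (x≤ω'' : x ≤S ω'') where
    open DecPreorder x (proj₁ Ωx) using () renaming (_≃_ to _≃ˣ_; _≃?_ to _≃ˣ?_; ≃-trans to ≃ˣ-trans; ≃-sym to ≃ˣ-sym)

    -- If x merges b₁ and b₂, then by (P1) for x each near block is comparable with b₁ in x,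
    -- and x ≤S ω'' forces the orientation chosen in ω''; so ω'' ≤S x.
    merging⇒ω''≤x : b₁ ≃ˣ b₂ → ω'' ≤S x
    merging⇒ω''≤x b₁≃ˣb₂ = ω''-least x (proj₁ Ωx) ω≤x b₁≃ˣb₂ down-below up-above
      where
      open Collapse x (proj₁ Ωx) ω≤x b₁≃ˣb₂ using (near-overlaps)

      down-below : ∀ {d} → NearDown d → _≼_ x d b₁
      down-below {d} down with proj₁ (proj₂ Ωx) d b₁ (near-overlaps (proj₁ down))
      ... | inj₁ d⊑ˣb₁ = d⊑ˣb₁
      ... | inj₂ b₁⊑ˣd = ⊥-elim (proj₁ (proj₁ down)
                                  (core⇒M (inj₂ (d , down , ⊑-refl d) , A.U-up⁺ (x≤ω'' _ _ b₁⊑ˣd) (proj₂ (M⇒core b₁∈M)))))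

      up-above : ∀ {d} → NearUp d → _≼_ x b₁ d
      up-above {d} up with proj₁ (proj₂ Ωx) d b₁ (near-overlaps (proj₁ up))
      ... | inj₂ b₁⊑ˣd = b₁⊑ˣd
      ... | inj₁ d⊑ˣb₁ = ⊥-elim (proj₁ (proj₁ up)
                                  (core⇒M (A.L-down⁺ (x≤ω'' _ _ d⊑ˣb₁) (proj₁ (M⇒core b₁∈M)) , inj₂ (d , up , ⊑-refl d))))

    separating⇒same-blocks : ¬ (b₁ ≃ˣ b₂) → ∀ {i j} → i ≃ˣ j → i ≃ j
    separating⇒same-blocks separate {i} {j} i≃ˣj with ≃″-cases (≈-mono x≤ω'' i≃ˣj)
    ... | inj₁ i≃j = i≃j
    ... | inj₂ (i∈M , j∈M) = within-M i∈M j∈M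
      where
      within-M : InM i → InM j → i ≃ j
      within-M (inj₁ i≃b₁) (inj₁ j≃b₁) = ≃-trans i≃b₁ (≃-sym j≃b₁)
      within-M (inj₂ i≃b₂) (inj₂ j≃b₂) = ≃-trans i≃b₂ (≃-sym j≃b₂)
      within-M (inj₁ i≃b₁) (inj₂ j≃b₂) =
        ⊥-elim (separate (≃ˣ-trans (≃ˣ-trans (≈-mono ω≤x (≃-sym i≃b₁)) i≃ˣj) (≈-mono ω≤x j≃b₂)))
      within-M (inj₂ i≃b₂) (inj₁ j≃b₁) =
        ⊥-elim (separate (≃ˣ-trans (≃ˣ-trans (≈-mono ω≤x (≃-sym j≃b₁)) (≃ˣ-sym i≃ˣj)) (≈-mono ω≤x i≃b₂)))

    dichotomy : (x ≤S ω) ⊎ (ω'' ≤S x)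
    dichotomy with b₁ ≃ˣ? b₂
    ... | yes merges = inj₂ (merging⇒ω''≤x merges)
    ... | no separates =
          inj₁ (SameBlocks.x≤ω ω x (proj₁ Ωω) (proj₁ Ωx) P1ω (proj₂ (proj₂ Ωx)) ω≤x (separating⇒same-blocks separates))

  no-intermediate : ¬ (Σ (BRel n) λ x → IsPermPreorder x × (ω <S x) × (x <S ω''))
  no-intermediate (x , Ωx , (ω≤x , x≰ω) , (x≤ω'' , ω''≰x)) with Intermediate.dichotomy x Ωx ω≤x x≤ω''
  ... | inj₁ x≤ω = x≰ω x≤ω
  ... | inj₂ ω''≤x = ω''≰x ω''≤x

lemma4p7 : (n : ℕ) (ω ω' : BRel n) → IsPermPreorder ω → IsPermPreorder ω' → ω <S ω' →
    (b₁ b₂ : Fin n) → ¬ (_≈_ ω b₁ b₂) → Combinable ω b₁ b₂ → _≈_ ω' b₁ b₂ →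
    Σ (BRel n) λ ω'' → IsPermPreorder ω'' × (ω ⋖S ω'') × (ω'' ≤S ω') × _≈_ ω'' b₁ b₂
lemma4p7 n ω ω' Ωω Ωω' (ω≤ω' , _) b₁ b₂ b₁≉b₂ comb b₁≈'b₂ =
  ω'' , (ω''-preorder , ω''-P1 , ω''-P2) , (ω<ω'' b₁≉b₂ , no-intermediate) , ω''≤ω' , b₁≃″b₂
  where open Merge ω ω' Ωω Ωω' ω≤ω' b₁ b₂ comb b₁≈'b₂
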